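{- Let $n\geq0$ be an integer, $R$ a ring and $N$ an $R$-module, and put $w_0=\begin{pmatrix}0&1\\1&0\end{pmatrix}$. (i) For all $\phi\in C(G(F_\mathfrak{p})/K_\mathfrak{p}(\mathfrak{p}^n),N)$, $$\partial_0(W_{\mathfrak{p}^n}\phi)=\varpi_\mathfrak{p}^n.\,\mathrm{inv}\big(\partial_0(w_0.\phi)\big).$$ (ii) Assume $r\geq n$. Then for all $\phi\in C(G(F_\mathfrak{p})/K_\mathfrak{p}(\mathfrak{p}^n),N)$, $$\partial_r(\phi)=\mathrm{inv}\big(\partial_r(w_0.\phi)\big).$$
   Context: Let $F_\mathfrak{p}$ be a nonarchimedean local field with valuation ring $\mathcal{O}_\mathfrak{p}$, uniformizer $\varpi_\mathfrak{p}$, $U_\mathfrak{p}^{(0)}=\mathcal{O}_\mathfrak{p}^\ast$, $U_\mathfrak{p}^{(r)}=\{x\in\mathcal{O}_\mathfrak{p}^\ast:x\equiv1\bmod\mathfrak{p}^r\}$. Let $G=\mathrm{PGL}_2$ and $K_\mathfrak{p}(\mathfrak{p}^n)$ the image of matrices in $\mathrm{GL}_2(\mathcal{O}_\mathfrak{p})$ with lower-left entry in $\mathfrak{p}^n$. $C(G(F_\mathfrak{p})/K_\mathfrak{p}(\mathfrak{p}^n),N)$ denotes $N$-valued functions on $G(F_\mathfrak{p})/K_\mathfrak{p}(\mathfrak{p}^n)$, with $G(F_\mathfrak{p})$ acting by left translation $(h.\phi)(x)=\phi(h^{ -1}x)$. The Atkin–Lehner involution is $W_{\mathfrak{p}^n}\phi(x)=\phi\left(x\begin{pmatrix}0&1\\\varpi_\mathfrak{p}^n&0\end{pmatrix}\right)$.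 For a space $X$, $\mathrm{Dist}(X,N)=\mathrm{Hom}_\mathbb{Z}(C^0_c(X,\mathbb{Z}),N)$. For $r\geq0$ define $\partial_r\colon C(G(F_\mathfrak{p})/K_\mathfrak{p}(\mathfrak{p}^n),N)\to\mathrm{Dist}(F_\mathfrak{p}^\ast/U_\mathfrak{p}^{(r)},N)$ by $\partial_r(\phi)(\mathbf{1}_{xU_\mathfrak{p}^{(r)}})=\phi\left(\begin{pmatrix}x&0\\0&1\end{pmatrix}\begin{pmatrix}\varpi_\mathfrak{p}^r&1\\0&1\end{pmatrix}\right)$. The group $F_\mathfrak{p}^\ast$ acts on $\mathrm{Dist}(F_\mathfrak{p}^\ast/U_\mathfrak{p}^{(r)},N)$ by $(h.D)(\mathbf{1}_{xU_\mathfrak{p}^{(r)}})=D(\mathbf{1}_{h^{ -1}xU_\mathfrak{p}^{(r)}})$, and $\mathrm{inv}\colon\mathrm{Dist}(F_\mathfrak{p}^\ast/U_\mathfrak{p}^{(r)},N)\to\mathrm{Dist}(F_\mathfrak{p}^\ast/U_\mathfrak{p}^{(r)},N)$ is induced by inversion $x\mapsto x^{ -1}$, i.e. $\mathrm{inv}(D)(\mathbf{1}_{xU_\mathfrak{p}^{(r)}})=D(\mathbf{1}_{x^{ -1}U_\mathfrak{p}^{(r)}})$. -}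

module Defs where

open import Level using (Level; _⊔_; Lift) renaming (suc to lsuc)
open import Algebra.Bundles using (CommutativeRing; Ring)
open import Algebra.Module.Bundles using (LeftModule)
open import Data.Integer as ℤ using (ℤ; +_)
open import Data.Nat as ℕ using (ℕ)
open import Data.List using (List)
open import Data.List.Relation.Unary.All using (All)
open import Data.List.Relation.Unary.Any using (Any)
open import Data.Product using (Σ; Σ-syntax; ∃; ∃-syntax; _×_; _,_; proj₁; proj₂)
open import Data.Sum using (_⊎_)
open import Data.Maybe using (nothing)
open import Relation.Nullary using (¬_)
open import Relation.Binary.PropositionalEquality using (_≡_)

-- The value v 0 is irrelevant (v(0) = ∞ is encoded in _∈𝔭^_ below).

record NALocalField c ℓ : Set (lsuc (c ⊔ ℓ)) where
  field
    commutativeRing : CommutativeRing c ℓ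
  open CommutativeRing commutativeRing public
  field
    1≉0        : ¬ (1# ≈ 0#)
    _⁻¹        : Carrier → Carrier
    ⁻¹-inverse : ∀ x → ¬ (x ≈ 0#) → x * (x ⁻¹) ≈ 1#
    v          : Carrier → ℤ
    v-cong     : ∀ {x y} → ¬ (x ≈ 0#) → x ≈ y → v x ≡ v y
    v-mult     : ∀ x y → ¬ (x ≈ 0#) → ¬ (y ≈ 0#) → v (x * y) ≡ v x ℤ.+ v y
    v-ultra    : ∀ x y → ¬ (x ≈ 0#) → ¬ (y ≈ 0#) → ¬ ((x + y) ≈ 0#) →
                 (v x ℤ.⊓ v y) ℤ.≤ v (x + y)
    ϖ          : Carrier
    ϖ≉0        : ¬ (ϖ ≈ 0#)
    v-ϖ        : v ϖ ≡ + 1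

  _∈𝔭^_ : Carrier → ℤ → Set ℓ
  x ∈𝔭^ k = (x ≈ 0#) ⊎ Lift ℓ (k ℤ.≤ v x)

  _∈𝒪 : Carrier → Set ℓ
  x ∈𝒪 = x ∈𝔭^ (+ 0)

  _∈𝒪ˣ : Carrier → Set ℓ
  x ∈𝒪ˣ = ¬ (x ≈ 0#) × Lift ℓ (v x ≡ + 0)

  IsCauchy : (ℕ → Carrier) → Set ℓ
  IsCauchy a = ∀ (k : ℕ) → ∃[ M ] ∀ m m′ → M ℕ.≤ m → M ℕ.≤ m′ → (a m - a m′) ∈𝔭^ (+ k)

  ConvergesTo : (ℕ → Carrier) → Carrier → Set ℓ
  ConvergesTo a L = ∀ (k : ℕ) → ∃[ M ] ∀ m → M ℕ.≤ m → (a m - L) ∈𝔭^ (+ k)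

  field
    complete : ∀ (a : ℕ → Carrier) → IsCauchy a → ∃[ L ] ConvergesTo a L
    finiteResidue : ∃[ reps ] (All _∈𝒪 reps ×
                      (∀ x → x ∈𝒪 → Any (λ y → (x - y) ∈𝔭^ (+ 1)) reps))

module _ {c ℓ} (F : NALocalField c ℓ) where
  open NALocalField F

  record M₂ : Set c where
    constructor mat
    field a b c′ d : Carrier
  open M₂

  _·ₘ_ : M₂ → M₂ → M₂
  mat a₁ b₁ c₁ d₁ ·ₘ mat a₂ b₂ c₂ d₂ =
    mat (a₁ * a₂ + b₁ * c₂) (a₁ * b₂ + b₁ * d₂)
        (c₁ * a₂ + d₁ * c₂) (c₁ * b₂ + d₁ * d₂)

  det : M₂ → Carrier
  det (mat a b c′ d) = a * d - b * c′

  -- adjugate: adj g = det(g) g⁻¹, which represents g⁻¹ in PGL₂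
  adj : M₂ → M₂
  adj (mat a b c′ d) = mat d (- b) (- c′) a

  _≈ₘ_ : M₂ → M₂ → Set ℓ
  g ≈ₘ h = (a g ≈ a h) × (b g ≈ b h) × (c′ g ≈ c′ h) × (d g ≈ d h)

  private
    nz-* : ∀ {x y} → ¬ (x ≈ 0#) → ¬ (y ≈ 0#) → ¬ ((x * y) ≈ 0#)
    nz-* {x} {y} x≉0 y≉0 xy≈0 = y≉0 (begin
        y                   ≈⟨ sym (*-identityˡ y) ⟩
        1# * y              ≈⟨ *-congʳ (sym (trans (*-comm (x ⁻¹) x) (⁻¹-inverse x x≉0))) ⟩
        ((x ⁻¹) * x) * y    ≈⟨ *-assoc (x ⁻¹) x y ⟩
        (x ⁻¹) * (x * y)    ≈⟨ *-congˡ xy≈0 ⟩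
        (x ⁻¹) * 0#         ≈⟨ zeroʳ (x ⁻¹) ⟩
        0# ∎)
      where open import Relation.Binary.Reasoning.Setoid setoid

  IsGL₂ : M₂ → Set ℓ
  IsGL₂ g = ¬ (det g ≈ 0#)

  Fˣ : Set (c ⊔ ℓ)
  Fˣ = Σ[ x ∈ Carrier ] ¬ (x ≈ 0#)

  _·ˣ_ : Fˣ → Fˣ → Fˣ
  (x , p) ·ˣ (y , q) = x * y , nz-* p q

  _⁻¹ˣ : Fˣ → Fˣ
  (x , p) ⁻¹ˣ = x ⁻¹ , λ x⁻¹≈0 → 1≉0 (trans (sym (⁻¹-inverse x p))
                          (trans (*-congˡ x⁻¹≈0) (zeroʳ x)))

  ϖˣ : Fˣ
  ϖˣ = ϖ , ϖ≉0

  _^ˣ_ : Fˣ → ℕ → Fˣ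
  x ^ˣ ℕ.zero  = 1# , 1≉0
  x ^ˣ ℕ.suc k = x ·ˣ (x ^ˣ k)

  scalar : Fˣ → M₂
  scalar (z , _) = mat z 0# 0# z

  diag : Fˣ → M₂
  diag (x , _) = mat x 0# 0# 1#

  u : ℕ → M₂
  u r = mat (proj₁ (ϖˣ ^ˣ r)) 1# 0# 1#

  w₀ : M₂
  w₀ = mat 0# 1# 1# 0#

  wAL : ℕ → M₂
  wAL n = mat 0# 1# (proj₁ (ϖˣ ^ˣ n)) 0#

  InK : ℕ → M₂ → Set ℓ
  InK n (mat a b c′ d) =
    a ∈𝒪 × b ∈𝒪 × c′ ∈𝔭^ (+ n) × d ∈𝒪 × det (mat a b c′ d) ∈𝒪ˣ

  -- C(G(F)/K(𝔭^n), N) for G = PGL₂: functions on GL₂(F) (given as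
  -- functions on all 2×2 matrices, of which only the values on invertible
  -- matrices are constrained/used) that respect equality and are
  -- right-invariant under the centre and under K(𝔭^n), i.e. functions on
  -- PGL₂(F)/K(𝔭^n).
  record C[G/K] {r ℓr m ℓm} {R : Ring r ℓr} (N : LeftModule R m ℓm) (n : ℕ)
         : Set (c ⊔ ℓ ⊔ m ⊔ ℓm) where
    open LeftModule N using (Carrierᴹ; _≈ᴹ_)
    field
      fun      : M₂ → Carrierᴹ
      fun-cong : ∀ g h → IsGL₂ g → g ≈ₘ h → fun g ≈ᴹ fun h
      fun-Z    : ∀ g z → IsGL₂ g → fun (g ·ₘ scalar z) ≈ᴹ fun g
      fun-K    : ∀ g k → IsGL₂ g → InK n k → fun (g ·ₘ k) ≈ᴹ fun g

  module _ {r ℓr m ℓm} {R : Ring r ℓr} (N : LeftModule R m ℓm) where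
    open LeftModule N using (Carrierᴹ; _≈ᴹ_)

    -- left translation (h.φ)(x) = φ(h⁻¹ x), on underlying functions
    _▸_ : M₂ → (M₂ → Carrierᴹ) → (M₂ → Carrierᴹ)
    (h ▸ φ) x = φ (adj h ·ₘ x)

    W : ℕ → (M₂ → Carrierᴹ) → (M₂ → Carrierᴹ)
    W n φ x = φ (x ·ₘ wAL n)

    -- Dist(F^*/U^{(r)}, N): since F^*/U^{(r)} is discrete, C_c^0 is
    -- spanned by the indicators 1_{xU^{(r)}}, so a distribution is given
    -- by its values D(1_{xU^{(r)}}), recorded as a function of x ∈ F^*.
    Dist : ℕ → Set (c ⊔ ℓ ⊔ m)
    Dist _ = Fˣ → Carrierᴹ

    _≐_ : ∀ {r} → Dist r → Dist r → Set (c ⊔ ℓ ⊔ ℓm)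
    D₁ ≐ D₂ = ∀ x → D₁ x ≈ᴹ D₂ x

    ∂ : (r : ℕ) → (M₂ → Carrierᴹ) → Dist r
    ∂ r φ x = φ (diag x ·ₘ u r)

    _⋆_ : ∀ {r} → Fˣ → Dist r → Dist r
    (h ⋆ D) x = D ((h ⁻¹ˣ) ·ˣ x)

    inv : ∀ {r} → Dist r → Dist r
    inv D x = D (x ⁻¹ˣ)

{-# OPTIONS --safe #-}
-- Each identity compares the values of φ at two points of G(F), and these
-- points agree modulo the centre and K(𝔭ⁿ).  Writing u_r = (ϖ^r 1 ; 0 1), one has
--   diag(x,1) u_r = w₀⁻¹ diag(x⁻¹,1) u_r · (−1 0 ; ϖ^r 1) · (−x)
--   diag(x,1) u_0 (0 1 ; ϖⁿ 0) = w₀⁻¹ diag(ϖⁿx⁻¹,1) u_0 · (1 −1 ; 0 1)(1 0 ; ϖⁿ 1) · (−x)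
-- where (−x) is a scalar matrix; the middle factors lie in K(𝔭ⁿ) because their
-- determinants are ±1 and their lower-left entries ϖ^r, ϖⁿ lie in 𝔭ⁿ, which for
-- the first identity is exactly the hypothesis r ≥ n.
module Submission where

open import Defs
open import Level using (Level; lift)
open import Algebra.Bundles using (Ring; CommutativeRing)
open import Algebra.Module.Bundles using (LeftModule)
open import Data.Nat as ℕ using (ℕ; zero; suc; _≤_)
open import Data.Integer as ℤ using (ℤ; +_; -[1+_]; _⊖_)
import Data.Integer.Properties as ℤP
import Data.Nat.Properties as ℕP
open import Data.Product using (_×_; _,_; proj₁; proj₂)
open import Data.Sum using (inj₁; inj₂)
open import Data.Maybe using (Maybe; just; nothing)
open import Relation.Nullary using (yes; no; ¬_)
import Relation.Binary.PropositionalEquality as ≡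
open import Algebra.Solver.Ring.AlmostCommutativeRing
  using (_-Raw-AlmostCommutative⟶_; fromCommutativeRing)

-- Tactic.RingSolver cannot cancel coefficients taken from an abstract ring, so
-- Algebra.Solver.Ring is instantiated with integer coefficients via ℤ → R.
module IntegerCoefficients {c ℓ} (R : CommutativeRing c ℓ) where
  open CommutativeRing R
  open import Algebra.Properties.Ring ring
    using (-0#≈0#; -‿involutive; -‿+-comm; -‿distribʳ-*; -‿distribˡ-*)
  open import Algebra.Properties.Semiring.Mult.TCOptimised semiring
    using (1+×; ×-homo-+; ×-cong; ×1-homo-*) renaming (_×_ to _×′_)
  open import Algebra.Properties.CommutativeSemigroup +-commutativeSemigroup
    using (interchange)
  open import Relation.Binary.Reasoning.Setoid setoid

  ⟦_⟧ℤ : ℤ → Carrier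
  ⟦ + n ⟧ℤ      = n ×′ 1#
  ⟦ -[1+ n ] ⟧ℤ = - (suc n ×′ 1#)

  -‿homo : ∀ i → ⟦ ℤ.- i ⟧ℤ ≈ - ⟦ i ⟧ℤ
  -‿homo (+ zero)  = sym -0#≈0#
  -‿homo (+ suc n) = refl
  -‿homo -[1+ n ]  = sym (-‿involutive _)

  x+y-[x+z]≈y-z : ∀ a b c → (a + b) - (a + c) ≈ b - c
  x+y-[x+z]≈y-z a b c = begin
    (a + b) + - (a + c)    ≈⟨ +-congˡ (-‿+-comm a c) ⟨
    (a + b) + (- a + - c)  ≈⟨ interchange a b (- a) (- c) ⟩
    (a - a) + (b - c)      ≈⟨ +-congʳ (-‿inverseʳ a) ⟩
    0# + (b - c)           ≈⟨ +-identityˡ _ ⟩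
    b - c                  ∎

  ⊖-homo : ∀ m n → ⟦ m ⊖ n ⟧ℤ ≈ m ×′ 1# - n ×′ 1#
  ⊖-homo zero    zero    = sym (-‿inverseʳ 0#)
  ⊖-homo zero    (suc n) = sym (+-identityˡ _)
  ⊖-homo (suc m) zero    = sym (trans (+-congˡ -0#≈0#) (+-identityʳ _))
  ⊖-homo (suc m) (suc n) = begin
    ⟦ suc m ⊖ suc n ⟧ℤ                   ≡⟨ ≡.cong ⟦_⟧ℤ (ℤP.[1+m]⊖[1+n]≡m⊖n m n) ⟩
    ⟦ m ⊖ n ⟧ℤ                           ≈⟨ ⊖-homo m n ⟩
    m ×′ 1# - n ×′ 1#                    ≈⟨ x+y-[x+z]≈y-z 1# _ _ ⟨
    (1# + m ×′ 1#) - (1# + n ×′ 1#)      ≈⟨ +-cong (1+× m 1#) (-‿cong (1+× n 1#)) ⟨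
    suc m ×′ 1# - suc n ×′ 1#            ∎

  +-homo : ∀ i j → ⟦ i ℤ.+ j ⟧ℤ ≈ ⟦ i ⟧ℤ + ⟦ j ⟧ℤ
  +-homo (+ m)     (+ n)     = ×-homo-+ 1# m n
  +-homo (+ m)     -[1+ n ]  = ⊖-homo m (suc n)
  +-homo -[1+ m ]  (+ n)     = trans (⊖-homo n (suc m)) (+-comm _ _)
  +-homo -[1+ m ]  -[1+ n ]  = begin
    - (suc (suc (m ℕ.+ n)) ×′ 1#)          ≈⟨ -‿cong (×-cong (ℕP.+-suc (suc m) n) refl) ⟨
    - ((suc m ℕ.+ suc n) ×′ 1#)            ≈⟨ -‿cong (×-homo-+ 1# (suc m) (suc n)) ⟩
    - (suc m ×′ 1# + suc n ×′ 1#)          ≈⟨ -‿+-comm _ _ ⟨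
    - (suc m ×′ 1#) + - (suc n ×′ 1#)      ∎

  *-homo-+ : ∀ m j → ⟦ + m ℤ.* j ⟧ℤ ≈ ⟦ + m ⟧ℤ * ⟦ j ⟧ℤ
  *-homo-+ m (+ n) = begin
    ⟦ + m ℤ.* + n ⟧ℤ        ≡⟨ ≡.cong ⟦_⟧ℤ (ℤP.pos-* m n) ⟨
    (m ℕ.* n) ×′ 1#         ≈⟨ ×1-homo-* m n ⟩
    m ×′ 1# * n ×′ 1#       ∎
  *-homo-+ m -[1+ n ] = begin
    ⟦ + m ℤ.* ℤ.- + suc n ⟧ℤ       ≡⟨ ≡.cong ⟦_⟧ℤ (ℤP.neg-distribʳ-* (+ m) (+ suc n)) ⟨
    ⟦ ℤ.- (+ m ℤ.* + suc n) ⟧ℤ     ≈⟨ -‿homo (+ m ℤ.* + suc n) ⟩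
    - ⟦ + m ℤ.* + suc n ⟧ℤ         ≈⟨ -‿cong (*-homo-+ m (+ suc n)) ⟩
    - (m ×′ 1# * suc n ×′ 1#)      ≈⟨ -‿distribʳ-* _ _ ⟩
    m ×′ 1# * - (suc n ×′ 1#)      ∎

  *-homo : ∀ i j → ⟦ i ℤ.* j ⟧ℤ ≈ ⟦ i ⟧ℤ * ⟦ j ⟧ℤ
  *-homo (+ m)    j = *-homo-+ m j
  *-homo -[1+ m ] j = begin
    ⟦ ℤ.- + suc m ℤ.* j ⟧ℤ         ≡⟨ ≡.cong ⟦_⟧ℤ (ℤP.neg-distribˡ-* (+ suc m) j) ⟨
    ⟦ ℤ.- (+ suc m ℤ.* j) ⟧ℤ       ≈⟨ -‿homo (+ suc m ℤ.* j) ⟩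
    - ⟦ + suc m ℤ.* j ⟧ℤ           ≈⟨ -‿cong (*-homo-+ (suc m) j) ⟩
    - (suc m ×′ 1# * ⟦ j ⟧ℤ)       ≈⟨ -‿distribˡ-* _ _ ⟩
    - (suc m ×′ 1#) * ⟦ j ⟧ℤ       ∎

  ℤ-morphism : ℤ.+-*-rawRing -Raw-AlmostCommutative⟶ fromCommutativeRing R
  ℤ-morphism = record
    { ⟦_⟧ = ⟦_⟧ℤ ; +-homo = +-homo ; *-homo = *-homo ; -‿homo = -‿homo
    ; 0-homo = refl ; 1-homo = refl }

  ⟦⟧ℤ-≟ : ∀ i j → Maybe (⟦ i ⟧ℤ ≈ ⟦ j ⟧ℤ)
  ⟦⟧ℤ-≟ i j with i ℤ.≟ j
  ... | yes ≡.refl = just refl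
  ... | no _       = nothing

  open import Algebra.Solver.Ring ℤ.+-*-rawRing (fromCommutativeRing R) ℤ-morphism ⟦⟧ℤ-≟ public

i+i≡0⇒i≡0 : ∀ (i : ℤ) → i ℤ.+ i ≡.≡ + 0 → i ≡.≡ + 0
i+i≡0⇒i≡0 (+ zero)  _ = ≡.refl
i+i≡0⇒i≡0 (+ suc k) ()
i+i≡0⇒i≡0 -[1+ k ]  ()

module LocalField {c ℓ} (F : NALocalField c ℓ) where
  open NALocalField F
  open IntegerCoefficients commutativeRing
  open import Algebra.Properties.Ring ring using (-‿involutive; -0#≈0#; -1*x≈-x)
  open import Relation.Binary.Reasoning.Setoid setoid

  infixl 7 _·_
  _·_ : M₂ F → M₂ F → M₂ F
  _·_ = _·ₘ_ F

  *-≉0 : ∀ {x y} → ¬ x ≈ 0# → ¬ y ≈ 0# → ¬ (x * y) ≈ 0#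
  *-≉0 x≉0 y≉0 = proj₂ (_·ˣ_ F (_ , x≉0) (_ , y≉0))

  -‿≉0 : ∀ {x} → ¬ x ≈ 0# → ¬ (- x) ≈ 0#
  -‿≉0 {x} x≉0 -x≈0 = x≉0 (begin
    x       ≈⟨ -‿involutive x ⟨
    - - x   ≈⟨ -‿cong -x≈0 ⟩
    - 0#    ≈⟨ -0#≈0# ⟩
    0#      ∎)

  ≉0-resp : ∀ {x y} → x ≈ y → ¬ y ≈ 0# → ¬ x ≈ 0#
  ≉0-resp x≈y y≉0 x≈0 = y≉0 (trans (sym x≈y) x≈0)

  -ˣ_ : Fˣ F → Fˣ F
  -ˣ (x , x≉0) = - x , -‿≉0 x≉0

  ⁻¹-inverseˡ : ∀ x → ¬ x ≈ 0# → x ⁻¹ * x ≈ 1#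
  ⁻¹-inverseˡ x x≉0 = trans (*-comm (x ⁻¹) x) (⁻¹-inverse x x≉0)

  [a⁻¹x]⁻¹x≈a : ∀ (a x : Fˣ F) →
                proj₁ (_⁻¹ˣ F (_·ˣ_ F (_⁻¹ˣ F a) x)) * proj₁ x ≈ proj₁ a
  [a⁻¹x]⁻¹x≈a (a , a≉0) (x , x≉0) = begin
    w ⁻¹ * x              ≈⟨ *-congˡ wa≈x ⟨
    w ⁻¹ * (w * a)        ≈⟨ *-assoc _ _ _ ⟨
    (w ⁻¹ * w) * a        ≈⟨ *-congʳ (⁻¹-inverseˡ w w≉0) ⟩
    1# * a                ≈⟨ *-identityˡ a ⟩
    a                     ∎
    where
    w : Carrier
    w = a ⁻¹ * x
    w≉0 : ¬ w ≈ 0#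
    w≉0 = proj₂ (_·ˣ_ F (_⁻¹ˣ F (a , a≉0)) (x , x≉0))
    wa≈x : w * a ≈ x
    wa≈x = begin
      (a ⁻¹ * x) * a   ≈⟨ solve 3 (λ a′ x a → (a′ :* x) :* a := (a′ :* a) :* x) refl (a ⁻¹) x a ⟩
      (a ⁻¹ * a) * x   ≈⟨ *-congʳ (⁻¹-inverseˡ a a≉0) ⟩
      1# * x           ≈⟨ *-identityˡ x ⟩
      x                ∎

  v-1#≡0 : v 1# ≡.≡ + 0
  v-1#≡0 = identityˡ-unique (v 1#) (v 1#)
    (≡.trans (≡.sym (v-mult 1# 1# 1≉0 1≉0)) (v-cong (*-≉0 1≉0 1≉0) (*-identityʳ 1#)))
    where open import Algebra.Properties.AbelianGroup ℤP.+-0-abelianGroup using (identityˡ-unique)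

  v-[-1#]≡0 : v (- 1#) ≡.≡ + 0
  v-[-1#]≡0 = i+i≡0⇒i≡0 (v (- 1#))
    (≡.trans (≡.sym (v-mult (- 1#) (- 1#) -1≉0 -1≉0))
      (≡.trans (v-cong (*-≉0 -1≉0 -1≉0) [-1]*[-1]≈1) v-1#≡0))
    where
    -1≉0 : ¬ (- 1#) ≈ 0#
    -1≉0 = -‿≉0 1≉0
    [-1]*[-1]≈1 : - 1# * - 1# ≈ 1#
    [-1]*[-1]≈1 = trans (-1*x≈-x (- 1#)) (-‿involutive 1#)

  v-ϖ^ : ∀ n → v (proj₁ (_^ˣ_ F (ϖˣ F) n)) ≡.≡ + n
  v-ϖ^ zero    = v-1#≡0
  v-ϖ^ (suc n) = ≡.trans (v-mult ϖ _ ϖ≉0 (proj₂ (_^ˣ_ F (ϖˣ F) n)))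
                         (≡.cong₂ ℤ._+_ v-ϖ (v-ϖ^ n))

  ∈𝒪ˣ-resp : ∀ {x y} → x ≈ y → x ∈𝒪ˣ → y ∈𝒪ˣ
  ∈𝒪ˣ-resp x≈y (x≉0 , lift vx≡0) =
    ≉0-resp (sym x≈y) x≉0 , lift (≡.trans (≡.sym (v-cong x≉0 x≈y)) vx≡0)

  𝒪ˣ⊆𝒪 : ∀ {x} → x ∈𝒪ˣ → x ∈𝒪
  𝒪ˣ⊆𝒪 (_ , lift vx≡0) = inj₂ (lift (ℤP.≤-reflexive (≡.sym vx≡0)))

  1∈𝒪ˣ : 1# ∈𝒪ˣ
  1∈𝒪ˣ = 1≉0 , lift v-1#≡0

  -1∈𝒪ˣ : (- 1#) ∈𝒪ˣ
  -1∈𝒪ˣ = -‿≉0 1≉0 , lift v-[-1#]≡0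

  0∈𝔭^ : ∀ k → 0# ∈𝔭^ k
  0∈𝔭^ k = inj₁ refl

  ϖ^∈𝔭^ : ∀ {n s} → n ≤ s → proj₁ (_^ˣ_ F (ϖˣ F) s) ∈𝔭^ (+ n)
  ϖ^∈𝔭^ {s = s} n≤s = inj₂ (lift (≡.subst (+ _ ℤ.≤_) (≡.sym (v-ϖ^ s)) (ℤ.+≤+ n≤s)))

  -- _·ᴾ_ and detᴾ mirror _·ₘ_ and det, so that ⟦_⟧ of an entry of a product of
  -- polynomial matrices unfolds to the same entry of the matrix product.
  record M₂ᴾ (k : ℕ) : Set where
    constructor matᴾ
    field aᴾ bᴾ cᴾ dᴾ : Polynomial k
  open M₂ᴾ

  infixl 7 _·ᴾ_
  _·ᴾ_ : ∀ {k} → M₂ᴾ k → M₂ᴾ k → M₂ᴾ k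
  matᴾ a₁ b₁ c₁ d₁ ·ᴾ matᴾ a₂ b₂ c₂ d₂ =
    matᴾ (a₁ :* a₂ :+ b₁ :* c₂) (a₁ :* b₂ :+ b₁ :* d₂)
         (c₁ :* a₂ :+ d₁ :* c₂) (c₁ :* b₂ :+ d₁ :* d₂)

  detᴾ : ∀ {k} → M₂ᴾ k → Polynomial k
  detᴾ (matᴾ a b c d) = a :* d :- b :* c

  0ᴾ 1ᴾ : ∀ {k} → Polynomial k
  0ᴾ = con (+ 0)
  1ᴾ = con (+ 1)

  det-· : ∀ g h → det F (g · h) ≈ det F g * det F h
  det-· (mat a₁ b₁ c₁ d₁) (mat a₂ b₂ c₂ d₂) =
    solve 8 (λ a₁ b₁ c₁ d₁ a₂ b₂ c₂ d₂ →
      detᴾ (matᴾ a₁ b₁ c₁ d₁ ·ᴾ matᴾ a₂ b₂ c₂ d₂) := detᴾ (matᴾ a₁ b₁ c₁ d₁) :* detᴾ (matᴾ a₂ b₂ c₂ d₂))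
      refl a₁ b₁ c₁ d₁ a₂ b₂ c₂ d₂

  det-cong : ∀ {g h} → _≈ₘ_ F g h → det F g ≈ det F h
  det-cong {mat _ _ _ _} {mat _ _ _ _} (a≈ , b≈ , c≈ , d≈) =
    +-cong (*-cong a≈ d≈) (-‿cong (*-cong b≈ c≈))

  IsGL₂-· : ∀ {g h} → IsGL₂ F g → IsGL₂ F h → IsGL₂ F (g · h)
  IsGL₂-· {g} {h} g∈GL h∈GL = ≉0-resp (det-· g h) (*-≉0 g∈GL h∈GL)

  IsGL₂-resp : ∀ {g h} → _≈ₘ_ F g h → IsGL₂ F h → IsGL₂ F g
  IsGL₂-resp g≈h = ≉0-resp (det-cong g≈h)

  IsGL₂-scalar : ∀ z → IsGL₂ F (scalar F z)
  IsGL₂-scalar (z , z≉0) = ≉0-resp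
    (solve 1 (λ z → detᴾ (matᴾ z 0ᴾ 0ᴾ z) := z :* z) refl z) (*-≉0 z≉0 z≉0)

  IsGL₂-adj-w₀ : IsGL₂ F (adj F (w₀ F))
  IsGL₂-adj-w₀ = ≉0-resp
    (solve 0 (detᴾ (matᴾ 0ᴾ (:- 1ᴾ) (:- 1ᴾ) 0ᴾ) := :- 1ᴾ) refl) (-‿≉0 1≉0)

  IsGL₂-diag-u : ∀ x r → IsGL₂ F (diag F x · u F r)
  IsGL₂-diag-u (x , x≉0) r = ≉0-resp
    (solve 2 (λ x q → detᴾ (matᴾ x 0ᴾ 0ᴾ 1ᴾ ·ᴾ matᴾ q 1ᴾ 0ᴾ 1ᴾ) := x :* q) refl x q)
    (*-≉0 x≉0 (proj₂ ϖ^r))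
    where
    ϖ^r : Fˣ F
    ϖ^r = _^ˣ_ F (ϖˣ F) r
    q : Carrier
    q = proj₁ ϖ^r

  IsGL₂-w₀⁻¹-diag-u : ∀ y s → IsGL₂ F (adj F (w₀ F) · (diag F y · u F s))
  IsGL₂-w₀⁻¹-diag-u y s = IsGL₂-· IsGL₂-adj-w₀ (IsGL₂-diag-u y s)


  InK⇒IsGL₂ : ∀ {n} k → InK F n k → IsGL₂ F k
  InK⇒IsGL₂ (mat _ _ _ _) (_ , _ , _ , _ , det∈𝒪ˣ) = proj₁ det∈𝒪ˣ

  upper∈K : ∀ {n b} → b ∈𝒪 → InK F n (mat 1# b 0# 1#)
  upper∈K {b = b} b∈𝒪 = 𝒪ˣ⊆𝒪 1∈𝒪ˣ , b∈𝒪 , 0∈𝔭^ _ , 𝒪ˣ⊆𝒪 1∈𝒪ˣ ,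
    ∈𝒪ˣ-resp (solve 1 (λ b → 1ᴾ := detᴾ (matᴾ 1ᴾ b 0ᴾ 1ᴾ)) refl b) 1∈𝒪ˣ

  lower∈K : ∀ {n a c} → a ∈𝒪ˣ → c ∈𝔭^ (+ n) → InK F n (mat a 0# c 1#)
  lower∈K {a = a} {c} a∈𝒪ˣ c∈𝔭ⁿ = 𝒪ˣ⊆𝒪 a∈𝒪ˣ , 0∈𝔭^ _ , c∈𝔭ⁿ , 𝒪ˣ⊆𝒪 1∈𝒪ˣ ,
    ∈𝒪ˣ-resp (solve 2 (λ a c → a := detᴾ (matᴾ a 0ᴾ c 1ᴾ)) refl a c) a∈𝒪ˣ

  diag-u-w₀-factorisation :
    ∀ (x y : Fˣ F) q → proj₁ y * proj₁ x ≈ 1# →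
    _≈ₘ_ F (diag F x · mat q 1# 0# 1#)
           (((adj F (w₀ F) · (diag F y · mat q 1# 0# 1#)) · mat (- 1#) 0# q 1#) · scalar F (-ˣ x))
  diag-u-w₀-factorisation (x , _) (y , _) q yx≈1 =
    solve 3 (λ x y q → aᴾ (lhs x q) := aᴾ (rhs x y q)) refl x y q ,
    solve 3 (λ x y q → bᴾ (lhs x q) := bᴾ (rhs x y q)) refl x y q ,
    solve 3 (λ x y q → cᴾ (lhs x q) := cᴾ (rhs x y q)) refl x y q ,
    trans (solve 3 (λ x y q → dᴾ (lhs x q) := 1ᴾ) refl x y q)
      (trans (sym yx≈1) (solve 3 (λ x y q → y :* x := dᴾ (rhs x y q)) refl x y q))
    where
    lhs : ∀ {k} → Polynomial k → Polynomial k → M₂ᴾ k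
    lhs x q = matᴾ x 0ᴾ 0ᴾ 1ᴾ ·ᴾ matᴾ q 1ᴾ 0ᴾ 1ᴾ
    rhs : ∀ {k} → Polynomial k → Polynomial k → Polynomial k → M₂ᴾ k
    rhs x y q = ((matᴾ 0ᴾ (:- 1ᴾ) (:- 1ᴾ) 0ᴾ ·ᴾ (matᴾ y 0ᴾ 0ᴾ 1ᴾ ·ᴾ matᴾ q 1ᴾ 0ᴾ 1ᴾ))
                 ·ᴾ matᴾ (:- 1ᴾ) 0ᴾ q 1ᴾ) ·ᴾ matᴾ (:- x) 0ᴾ 0ᴾ (:- x)

  diag-u-wAL-w₀-factorisation :
    ∀ (x y : Fˣ F) p → proj₁ y * proj₁ x ≈ p →
    _≈ₘ_ F ((diag F x · mat 1# 1# 0# 1#) · mat 0# 1# p 0#)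
           ((((adj F (w₀ F) · (diag F y · mat 1# 1# 0# 1#)) · mat 1# (- 1#) 0# 1#)
             · mat 1# 0# p 1#) · scalar F (-ˣ x))
  diag-u-wAL-w₀-factorisation (x , _) (y , _) p yx≈p =
    solve 3 (λ x y p → aᴾ (lhs x p) := aᴾ (rhs x y p)) refl x y p ,
    solve 3 (λ x y p → bᴾ (lhs x p) := bᴾ (rhs x y p)) refl x y p ,
    trans (solve 3 (λ x y p → cᴾ (lhs x p) := p) refl x y p)
      (trans (sym yx≈p) (solve 3 (λ x y p → y :* x := cᴾ (rhs x y p)) refl x y p)) ,
    solve 3 (λ x y p → dᴾ (lhs x p) := dᴾ (rhs x y p)) refl x y p
    where
    lhs : ∀ {k} → Polynomial k → Polynomial k → M₂ᴾ k
    lhs x p = (matᴾ x 0ᴾ 0ᴾ 1ᴾ ·ᴾ matᴾ 1ᴾ 1ᴾ 0ᴾ 1ᴾ) ·ᴾ matᴾ 0ᴾ 1ᴾ p 0ᴾ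
    rhs : ∀ {k} → Polynomial k → Polynomial k → Polynomial k → M₂ᴾ k
    rhs x y p = (((matᴾ 0ᴾ (:- 1ᴾ) (:- 1ᴾ) 0ᴾ ·ᴾ (matᴾ y 0ᴾ 0ᴾ 1ᴾ ·ᴾ matᴾ 1ᴾ 1ᴾ 0ᴾ 1ᴾ))
                  ·ᴾ matᴾ 1ᴾ (:- 1ᴾ) 0ᴾ 1ᴾ) ·ᴾ matᴾ 1ᴾ 0ᴾ p 1ᴾ) ·ᴾ matᴾ (:- x) 0ᴾ 0ᴾ (:- x)

module _ {c ℓ} {F : NALocalField c ℓ} {r ℓr m ℓm} {R : Ring r ℓr}
         (N : LeftModule R m ℓm) (n : ℕ) (φ : C[G/K] F N n) where
  open LocalField F
  open LeftModule N using (_≈ᴹ_; ≈ᴹ-trans)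
  open C[G/K] φ

  fun-resp-K·Z : ∀ {g h k} z → IsGL₂ F h → InK F n k →
                 _≈ₘ_ F g ((h · k) · scalar F z) → fun g ≈ᴹ fun h
  fun-resp-K·Z {g} {h} {k} z h∈GL k∈K g≈hkz =
    ≈ᴹ-trans (fun-cong g _ g∈GL g≈hkz) (≈ᴹ-trans (fun-Z (h · k) z hk∈GL) (fun-K h k h∈GL k∈K))
    where
    hk∈GL : IsGL₂ F (h · k)
    hk∈GL = IsGL₂-· h∈GL (InK⇒IsGL₂ k k∈K)
    g∈GL : IsGL₂ F g
    g∈GL = IsGL₂-resp g≈hkz (IsGL₂-· hk∈GL (IsGL₂-scalar z))

  ∂₀-W≐ϖⁿ⋆inv-∂₀-w₀ :
    _≐_ F N {0} (∂ F N 0 (W F N n fun))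
      (_⋆_ F N {0} (_^ˣ_ F (ϖˣ F) n) (inv F N {0} (∂ F N 0 (_▸_ F N (w₀ F) fun))))
  ∂₀-W≐ϖⁿ⋆inv-∂₀-w₀ x =
    ≈ᴹ-trans (fun-resp-K·Z (-ˣ x) (IsGL₂-· h∈GL (InK⇒IsGL₂ _ k₁∈K)) k₂∈K
               (diag-u-wAL-w₀-factorisation x y _ ([a⁻¹x]⁻¹x≈a ϖⁿ x)))
             (fun-K _ _ h∈GL k₁∈K)
    where
    open NALocalField F using (0#; 1#; -_)
    ϖⁿ y : Fˣ F
    ϖⁿ = _^ˣ_ F (ϖˣ F) n
    y = _⁻¹ˣ F (_·ˣ_ F (_⁻¹ˣ F ϖⁿ) x)
    h∈GL : IsGL₂ F (adj F (w₀ F) · (diag F y · u F 0))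
    h∈GL = IsGL₂-w₀⁻¹-diag-u y 0
    k₁∈K : InK F n (mat 1# (- 1#) 0# 1#)
    k₁∈K = upper∈K (𝒪ˣ⊆𝒪 -1∈𝒪ˣ)
    k₂∈K : InK F n (mat 1# 0# (proj₁ ϖⁿ) 1#)
    k₂∈K = lower∈K 1∈𝒪ˣ (ϖ^∈𝔭^ ℕP.≤-refl)

  ∂≐inv-∂-w₀ : ∀ s → n ≤ s →
    _≐_ F N {s} (∂ F N s fun) (inv F N {s} (∂ F N s (_▸_ F N (w₀ F) fun)))
  ∂≐inv-∂-w₀ s n≤s x =
    fun-resp-K·Z (-ˣ x) (IsGL₂-w₀⁻¹-diag-u x⁻¹ s) (lower∈K -1∈𝒪ˣ (ϖ^∈𝔭^ n≤s))
      (diag-u-w₀-factorisation x x⁻¹ _ (⁻¹-inverseˡ _ (proj₂ x)))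
    where
    x⁻¹ : Fˣ F
    x⁻¹ = _⁻¹ˣ F x

mainTheorem4 : ∀ {c ℓ r ℓr m ℓm : Level} (F : NALocalField c ℓ) (R : Ring r ℓr)
    (N : LeftModule R m ℓm) (n : ℕ) (φ : C[G/K] F N n) →
    (_≐_ F N {0} (∂ F N 0 (W F N n (C[G/K].fun φ)))
         (_⋆_ F N {0} (_^ˣ_ F (ϖˣ F) n) (inv F N {0} (∂ F N 0 (_▸_ F N (w₀ F) (C[G/K].fun φ))))))
    × (∀ (s : ℕ) → n ≤ s →
         _≐_ F N {s} (∂ F N s (C[G/K].fun φ))
           (inv F N {s} (∂ F N s (_▸_ F N (w₀ F) (C[G/K].fun φ)))))
mainTheorem4 F R N n φ = ∂₀-W≐ϖⁿ⋆inv-∂₀-w₀ N n φ , ∂≐inv-∂-w₀ N n φ
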